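{- Consider any combination of TRIP maps and let $(i_0,i_1,\dots)$ be a TRIP tree sequence with respect to it. For $n\ge0$ let $X_{n,1},X_{n,2},X_{n,3}$ be the columns of $BF^{(0)}_{i_0}\cdots F^{(n)}_{i_n}$ (the vertices of $\triangle(i_0,\dots,i_n)$ before projection) and $x_{n,j}$ the first coordinate of $X_{n,j}$. Suppose there exists a constant $C$ such that for every $n\ge0$ and every pair $1\le i,j\le 3$, $\frac{x_{n,i}}{x_{n,j}}\le C$. Then if $X_{n,i}$ is a vertex of $\triangle(i_0,\dots,i_n)$, it cannot be a vertex of $\triangle(i_0,\dots,i_{n+k})$ for any $k>2C^2$.
   Context: Let $B=\begin{pmatrix}1&1&1\\0&1&1\\0&0&1\end{pmatrix}$, $A_0=\begin{pmatrix}0&0&1\\1&0&0\\0&1&1\end{pmatrix}$, $A_1=\begin{pmatrix}1&0&1\\0&1&0\\0&0&1\end{pmatrix}$. A permutation $\rho\in S_3$ is identified with the permutation matrix $P_\rho$ having $(P_\rho)_{i,\rho(i)}=1$ and other entries $0$. A combination of TRIP maps is a sequence of triples $(\sigma^{(m)},\tau_0^{(m)},\tau_1^{(m)})\in S_3^3$, $m\ge0$, with $F^{(m)}_0=P_{\sigma^{(m)}}A_0P_{\tau^{(m)}_0}$, $F^{(m)}_1=P_{\sigma^{(m)}}A_1P_{\tau^{(m)}_1}$. Let $\pi(b_0,b_1,b_2)=(b_1/b_0,b_2/b_0)$ and $\triangle$ the closed triangle with vertices $(0,0),(1,0),(1,1)$. The triangle $\triangle(i_0,\dots,i_n)$ has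 as vertices the columns of $BF^{(0)}_{i_0}\cdots F^{(n)}_{i_n}$ (in $\mathbb{R}^3$; projected to $\mathbb{R}^2$ by $\pi$). A TRIP tree sequence of a point $p\in\triangle$ is a sequence $(i_0,i_1,\dots)\in\{0,1\}^{\mathbb{N}}$ with $p\in\triangle(i_0,\dots,i_n)$ for all $n$.
   Formalization: The constant C bounding the ratios of the first coordinates $x_{n,j}$ ranges over the rationals. -}

module Defs where

open import Data.Nat using (ℕ; zero; suc; _+_; _*_)
open import Data.Fin using (Fin)
open import Data.Fin.Patterns using (0F; 1F; 2F)
open import Data.Fin.Properties using (_≟_)
open import Data.Fin.Permutation using (Permutation′; _⟨$⟩ʳ_)
open import Data.Bool using (if_then_else_)
open import Data.Product using (_×_; _,_)
open import Data.Integer using (+_)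
open import Data.Rational using (ℚ; _/_)
open import Relation.Nullary.Decidable using (⌊_⌋)
open import Relation.Binary.PropositionalEquality using (_≡_)

Mat : Set
Mat = Fin 3 → Fin 3 → ℕ

_⊗_ : Mat → Mat → Mat
(M ⊗ N) i j = M i 0F * N 0F j + M i 1F * N 1F j + M i 2F * N 2F j

infixl 7 _⊗_

mat : ℕ → ℕ → ℕ → ℕ → ℕ → ℕ → ℕ → ℕ → ℕ → Mat
mat a b c d e f g h k 0F 0F = a
mat a b c d e f g h k 0F 1F = b
mat a b c d e f g h k 0F 2F = c
mat a b c d e f g h k 1F 0F = d
mat a b c d e f g h k 1F 1F = e
mat a b c d e f g h k 1F 2F = f
mat a b c d e f g h k 2F 0F = g
mat a b c d e f g h k 2F 1F = h
mat a b c d e f g h k 2F 2F = k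

B : Mat
B = mat 1 1 1
        0 1 1
        0 0 1

A₀ : Mat
A₀ = mat 0 0 1
         1 0 0
         0 1 1

A₁ : Mat
A₁ = mat 1 0 1
         0 1 0
         0 0 1

A : Fin 2 → Mat
A 0F = A₀
A 1F = A₁

P : Permutation′ 3 → Mat
P ρ i j = if ⌊ (ρ ⟨$⟩ʳ i) ≟ j ⌋ then 1 else 0

-- a combination of TRIP maps: for each m a triple (σ⁽ᵐ⁾, τ₀⁽ᵐ⁾, τ₁⁽ᵐ⁾)
Combination : Set
Combination = ℕ → Permutation′ 3 × Permutation′ 3 × Permutation′ 3

F : Combination → ℕ → Fin 2 → Mat
F c m 0F with c m
... | σ , τ₀ , τ₁ = P σ ⊗ A₀ ⊗ P τ₀
F c m 1F with c m
... | σ , τ₀ , τ₁ = P σ ⊗ A₁ ⊗ P τ₁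

vertexMatrix : Combination → (ℕ → Fin 2) → ℕ → Mat
vertexMatrix c s zero    = B ⊗ F c 0 (s 0)
vertexMatrix c s (suc n) = vertexMatrix c s n ⊗ F c (suc n) (s (suc n))

Vec3 : Set
Vec3 = Fin 3 → ℕ

X : Combination → (ℕ → Fin 2) → ℕ → Fin 3 → Vec3
X c s n j r = vertexMatrix c s n r j

x : Combination → (ℕ → Fin 2) → ℕ → Fin 3 → ℕ
x c s n j = X c s n j 0F

ℕtoℚ : ℕ → ℚ
ℕtoℚ n = + n / 1

-- π u ≡ π v for vectors with nonzero first coordinate, where
-- π (b₀ , b₁ , b₂) = (b₁ / b₀ , b₂ / b₀), written cross-multiplied
samePoint : Vec3 → Vec3 → Set
samePoint u v = (u 1F * v 0F ≡ v 1F * u 0F) × (u 2F * v 0F ≡ v 2F * u 0F)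

-- Let y n = (x n 0, x n 1, x n 2) be the first row of B F⁽⁰⁾ ⋯ F⁽ⁿ⁾, so y (n + 1) = y n · F⁽ⁿ⁺¹⁾.
-- A TRIP map permutes the entries of y and replaces one of them by the sum of two, so the
-- total of y grows at every step by one entry of y, and the largest entry never decreases.
-- If all ratios of entries are at most C = c / d and p = y n i, then after k steps the total
-- has grown by at least k p / C, while any triple containing p has total between p + 2 p / C
-- and p + 2 C p; so p can occur again in y (n + k) only if k ≤ 2 C².
-- The vertex matrices are invertible over ℤ, hence their columns are primitive vectors and
-- two of them on the same ray through the origin are equal; so a vertex of △(i₀,…,iₙ) that
-- is still a vertex of △(i₀,…,iₙ₊ₖ) reappears with the same first coordinate.
module Submission where

open import Defs

module VertexCoordinates where

  open import Data.Bool using (if_then_else_)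
  open import Data.Empty using (⊥; ⊥-elim)
  open import Data.Fin using (Fin; suc)
  open import Data.Fin.Patterns using (0F; 1F; 2F)
  open import Data.Fin.Permutation using (Permutation′; _⟨$⟩ʳ_; _⟨$⟩ˡ_; flip; inverseʳ; inverseˡ)
  open import Data.Fin.Properties using (_≟_; all?)
  open import Data.Integer as ℤ using (ℤ)
  import Data.Integer.Properties as ℤ
  open import Data.Integer.Tactic.RingSolver using () renaming (solve-∀ to ℤ-solve-∀)
  import Data.List as List
  open import Data.Nat as ℕ using (ℕ; zero; suc; _+_; _*_; _≤_; _<_; z≤n)
  import Data.Nat.Properties as ℕ
  open import Algebra.Properties.CommutativeMonoid.Sum ℕ.+-0-commutativeMonoid
    using (sum; sum-remove; sum-permute; sum-cong-≗)
  open import Data.Nat.Coprimality using (Coprime; 1-coprimeTo)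
  import Data.Nat.Coprimality as Coprimality
  open import Data.Nat.Divisibility using (_∣_; divides; ∣-antisym)
  open import Data.Nat.Tactic.RingSolver using (solve-∀; solve)
  open import Data.Product using (∃-syntax; _,_; proj₁; proj₂)
  open import Data.Rational as ℚ using (ℚ; mkℚ; toℚᵘ)
  open import Data.Rational.Properties using (normalize-coprime; toℚᵘ-mono-≤; toℚᵘ-mono-<; toℚᵘ-homo-*)
  import Data.Rational.Unnormalised as ℚᵘ
  import Data.Rational.Unnormalised.Properties as ℚᵘ
  open import Data.Vec.Functional using (Vector; removeAt; _∷_; [])
  open import Function using (_∘_)
  open import Function.Bundles using (Injection)
  open import Function.Definitions using (Injective)
  open import Function.Properties.Inverse using (↔⇒↣)
  open import Relation.Binary.PropositionalEquality
  open import Relation.Nullary.Decidable using (Dec; ⌊_⌋; yes; no; True; toWitness)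

  -- Vectors with bounded ratios

  record RatioBounded {n} (c d : ℕ) (v : Vector ℕ n) : Set where
    constructor ratio-bounded
    field ratio-bound : ∀ a b → d * v a ≤ c * v b

  open RatioBounded

  sum-lower-bound : ∀ {m} (w : Vector ℕ m) {q} c → (∀ k → q ≤ c * w k) → m * q ≤ c * sum w
  sum-lower-bound {zero}  w     c bounded = z≤n
  sum-lower-bound {suc m} w {q} c bounded = begin
    q + m * q                  ≤⟨ ℕ.+-mono-≤ (bounded 0F) (sum-lower-bound (w ∘ suc) c (bounded ∘ suc)) ⟩
    c * w 0F + c * sum (w ∘ suc) ≡⟨ ℕ.*-distribˡ-+ c _ _ ⟨
    c * sum w                  ∎
    where open ℕ.≤-Reasoning

  sum-upper-bound : ∀ {m} (w : Vector ℕ m) {q} d → (∀ k → d * w k ≤ q) → d * sum w ≤ m * q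
  sum-upper-bound {zero}  w     d bounded = ℕ.≤-reflexive (ℕ.*-zeroʳ d)
  sum-upper-bound {suc m} w {q} d bounded = begin
    d * sum w                  ≡⟨ ℕ.*-distribˡ-+ d _ _ ⟩
    d * w 0F + d * sum (w ∘ suc) ≤⟨ ℕ.+-mono-≤ (bounded 0F) (sum-upper-bound (w ∘ suc) d (bounded ∘ suc)) ⟩
    q + m * q                  ∎
    where open ℕ.≤-Reasoning

  module _ {n c d} {v : Vector ℕ (suc n)} (ratio : RatioBounded c d v) where

    ratio-sum-lower : ∀ i → c * v i + n * (d * v i) ≤ c * sum v
    ratio-sum-lower i = begin
      c * v i + n * (d * v i)          ≤⟨ ℕ.+-monoʳ-≤ (c * v i) others-lower ⟩
      c * v i + c * sum (removeAt v i) ≡⟨ ℕ.*-distribˡ-+ c _ _ ⟨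
      c * (v i + sum (removeAt v i))   ≡⟨ cong (c *_) (sum-remove v) ⟨
      c * sum v                        ∎
      where
      open ℕ.≤-Reasoning
      others-lower : n * (d * v i) ≤ c * sum (removeAt v i)
      others-lower = sum-lower-bound (removeAt v i) c (λ k → ratio-bound ratio i _)

    ratio-sum-upper : ∀ j → d * sum v ≤ d * v j + n * (c * v j)
    ratio-sum-upper j = begin
      d * sum v                        ≡⟨ cong (d *_) (sum-remove v) ⟩
      d * (v j + sum (removeAt v j))   ≡⟨ ℕ.*-distribˡ-+ d _ _ ⟩
      d * v j + d * sum (removeAt v j) ≤⟨ ℕ.+-monoʳ-≤ (d * v j) others-upper ⟩
      d * v j + n * (c * v j)          ∎
      where
      open ℕ.≤-Reasoning
      others-upper : d * sum (removeAt v j) ≤ n * (c * v j)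
      others-upper = sum-upper-bound (removeAt v j) d (λ k → ratio-bound ratio _ j)

  revisit-arithmetic : ∀ {n c d} p q r k → 1 ≤ p →
    c * q + k * (d * p) ≤ c * r → c * p + n * (d * p) ≤ c * q → d * r ≤ d * p + n * (c * p) →
    k * (d * d) ≤ n * (c * c)
  revisit-arithmetic {n} {c} {d} p q r k 1≤p growth lower upper =
    ℕ.*-cancelʳ-≤ _ _ p {{ℕ.>-nonZero 1≤p}} (ℕ.≤-trans (ℕ.m≤n+m _ _) (ℕ.+-cancelˡ-≤ (c * d * p) _ _ chain))
    where
    open ℕ.≤-Reasoning
    chain : c * d * p + (n * (d * d) * p + k * (d * d) * p) ≤ c * d * p + n * (c * c) * p
    chain = begin
      c * d * p + (n * (d * d) * p + k * (d * d) * p)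
        ≡⟨ solve (n List.∷ c List.∷ d List.∷ p List.∷ k List.∷ List.[]) ⟩
      d * (c * p + n * (d * p)) + d * (k * (d * p))
        ≤⟨ ℕ.+-monoˡ-≤ _ (ℕ.*-monoʳ-≤ d lower) ⟩
      d * (c * q) + d * (k * (d * p))
        ≡⟨ ℕ.*-distribˡ-+ d _ _ ⟨
      d * (c * q + k * (d * p))
        ≤⟨ ℕ.*-monoʳ-≤ d growth ⟩
      d * (c * r)
        ≡⟨ solve (c List.∷ d List.∷ r List.∷ List.[]) ⟩
      c * (d * r)
        ≤⟨ ℕ.*-monoʳ-≤ c upper ⟩
      c * (d * p + n * (c * p))
        ≡⟨ solve (n List.∷ c List.∷ d List.∷ p List.∷ List.[]) ⟩
      c * d * p + n * (c * c) * p
        ∎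

  -- Growth of sums under refinement

  record Refines {n} (y z : Vector ℕ n) : Set where
    field
      total-grows : ∃[ a ] sum z ≡ sum y + y a
      max-mono    : ∀ i → ∃[ j ] y i ≤ z j
      min-mono    : ∀ j → ∃[ i ] y i ≤ z j

  open Refines

  module _ {n} {y z : Vector ℕ n} where

    Refines-congʳ : ∀ {z′} → Refines y z → z ≗ z′ → Refines y z′
    Refines-congʳ r z≗z′ = record
      { total-grows = let a , eq = total-grows r in a , trans (sym (sum-cong-≗ z≗z′)) eq
      ; max-mono    = λ i → let j , le = max-mono r i in j , subst (y i ≤_) (z≗z′ j) le
      ; min-mono    = λ j → let i , le = min-mono r j in i , subst (y i ≤_) (z≗z′ j) le
      }

    Refines-rearrangeˡ : (π : Permutation′ n) → Refines (y ∘ (π ⟨$⟩ʳ_)) z → Refines y z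
    Refines-rearrangeˡ π r = record
      { total-grows = let a , eq = total-grows r in
                      π ⟨$⟩ʳ a , trans eq (cong (_+ y (π ⟨$⟩ʳ a)) (sym (sum-permute y π)))
      ; max-mono    = λ i → let j , le = max-mono r (π ⟨$⟩ˡ i) in j , subst (_≤ z j) (cong y (inverseʳ π)) le
      ; min-mono    = λ j → let i , le = min-mono r j in π ⟨$⟩ʳ i , le
      }

    Refines-rearrangeʳ : (π : Permutation′ n) → Refines y z → Refines y (z ∘ (π ⟨$⟩ʳ_))
    Refines-rearrangeʳ π r = record
      { total-grows = let a , eq = total-grows r in a , trans (sym (sum-permute z π)) eq
      ; max-mono    = λ i → let j , le = max-mono r i in π ⟨$⟩ˡ j , subst (y i ≤_) (cong z (sym (inverseʳ π))) le
      ; min-mono    = λ j → min-mono r (π ⟨$⟩ʳ j)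
      }

  Refines-positive : ∀ {n} {y z : Vector ℕ n} → Refines y z → (∀ i → 1 ≤ y i) → ∀ j → 1 ≤ z j
  Refines-positive r positive j = let i , le = min-mono r j in ℕ.≤-trans (positive i) le

  module _ {n} {y : ℕ → Vector ℕ (suc n)} (refines : ∀ m → Refines (y m) (y (suc m))) where

    max-mono-iterate : ∀ m i t → ∃[ l ] y m i ≤ y (t + m) l
    max-mono-iterate m i zero    = i , ℕ.≤-refl
    max-mono-iterate m i (suc t) =
      let l , le = max-mono-iterate m i t
          l′ , le′ = max-mono (refines (t + m)) l
      in l′ , ℕ.≤-trans le le′

    module _ {c d} (ratio : ∀ m → RatioBounded c d (y m)) where

      total-growth : ∀ m i t → c * sum (y m) + t * (d * y m i) ≤ c * sum (y (t + m))
      total-growth m i zero    = ℕ.≤-reflexive (ℕ.+-identityʳ _)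
      total-growth m i (suc t) = begin
        c * sum (y m) + (d * y m i + t * (d * y m i)) ≡⟨ cong (c * sum (y m) +_) (ℕ.+-comm (d * y m i) _) ⟩
        c * sum (y m) + (t * (d * y m i) + d * y m i) ≡⟨ ℕ.+-assoc (c * sum (y m)) _ _ ⟨
        c * sum (y m) + t * (d * y m i) + d * y m i   ≤⟨ ℕ.+-mono-≤ (total-growth m i t) entry-bound ⟩
        c * sum (y m′) + c * y m′ a                   ≡⟨ ℕ.*-distribˡ-+ c _ _ ⟨
        c * (sum (y m′) + y m′ a)                     ≡⟨ cong (c *_) (proj₂ (total-grows (refines m′))) ⟨
        c * sum (y (suc m′))                          ∎
        where
        open ℕ.≤-Reasoning
        m′ : ℕ
        m′ = t + m
        a : Fin (suc n)
        a = proj₁ (total-grows (refines m′))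
        entry-bound : d * y m i ≤ c * y m′ a
        entry-bound = let l , le = max-mono-iterate m i t in
                      ℕ.≤-trans (ℕ.*-monoʳ-≤ d le) (ratio-bound (ratio m′) l a)

      revisit-bound : ∀ m i k j → 1 ≤ y m i → y (m + k) j ≡ y m i → k * (d * d) ≤ n * (c * c)
      revisit-bound m i k j positive revisit =
        revisit-arithmetic {n} {c} {d} (y m i) (sum (y m)) (sum (y (k + m))) k positive
          (total-growth m i k) (ratio-sum-lower (ratio m) i) upper
        where
        upper : d * sum (y (k + m)) ≤ d * y m i + n * (c * y m i)
        upper = subst (λ p → d * sum (y (k + m)) ≤ d * p + n * (c * p))
                      (subst (λ t → y t j ≡ y m i) (ℕ.+-comm m k) revisit)
                      (ratio-sum-upper (ratio (k + m)) j)

  -- Row action of the TRIP matrices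

  infixl 7 _·_

  _·_ : Vec3 → Mat → Vec3
  (y · M) j = y 0F * M 0F j + y 1F * M 1F j + y 2F * M 2F j

  ·-⊗ : ∀ y M N → y · (M ⊗ N) ≗ y · M · N
  ·-⊗ y M N j = assoc (y 0F) (y 1F) (y 2F) (M 0F 0F) (M 0F 1F) (M 0F 2F) (M 1F 0F) (M 1F 1F) (M 1F 2F)
                      (M 2F 0F) (M 2F 1F) (M 2F 2F) (N 0F j) (N 1F j) (N 2F j)
    where
    assoc : ∀ y₀ y₁ y₂ m₀₀ m₀₁ m₀₂ m₁₀ m₁₁ m₁₂ m₂₀ m₂₁ m₂₂ n₀ n₁ n₂ →
        y₀ * (m₀₀ * n₀ + m₀₁ * n₁ + m₀₂ * n₂) + y₁ * (m₁₀ * n₀ + m₁₁ * n₁ + m₁₂ * n₂)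
        + y₂ * (m₂₀ * n₀ + m₂₁ * n₁ + m₂₂ * n₂)
      ≡ (y₀ * m₀₀ + y₁ * m₁₀ + y₂ * m₂₀) * n₀ + (y₀ * m₀₁ + y₁ * m₁₁ + y₂ * m₂₁) * n₁
        + (y₀ * m₀₂ + y₁ * m₁₂ + y₂ * m₂₂) * n₂
    assoc = solve-∀

  ·-congˡ : ∀ {y z} M → y ≗ z → y · M ≗ z · M
  ·-congˡ M y≗z j rewrite y≗z 0F | y≗z 1F | y≗z 2F = refl

  I : Mat
  I i j = if ⌊ i ≟ j ⌋ then 1 else 0

  I-diagonal : ∀ i → I i i ≡ 1
  I-diagonal 0F = refl
  I-diagonal 1F = refl
  I-diagonal 2F = refl

  I-injective : ∀ {f : Fin 3 → Fin 3} → Injective _≡_ _≡_ f → ∀ i j → I (f i) (f j) ≡ I i j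
  I-injective {f} f-injective i j with f i ≟ f j | i ≟ j
  ... | yes _     | yes _   = refl
  ... | no _      | no _    = refl
  ... | no fi≢fj  | yes i≡j = ⊥-elim (fi≢fj (cong f i≡j))
  ... | yes fi≡fj | no i≢j  = ⊥-elim (i≢j (f-injective fi≡fj))

  ⟨$⟩ˡ-injective : ∀ {n} (ρ : Permutation′ n) → Injective _≡_ _≡_ (ρ ⟨$⟩ˡ_)
  ⟨$⟩ˡ-injective ρ = Injection.injective (↔⇒↣ (flip ρ))

  P-as-I : ∀ ρ i j → P ρ i j ≡ I i (ρ ⟨$⟩ˡ j)
  P-as-I ρ i j = trans (sym (I-injective (⟨$⟩ˡ-injective ρ) (ρ ⟨$⟩ʳ i) j))
                       (cong (λ k → I k (ρ ⟨$⟩ˡ j)) (inverseˡ ρ))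

  private
    pick₀ : ∀ a b c → a * 1 + b * 0 + c * 0 ≡ a
    pick₀ = solve-∀
    pick₁ : ∀ a b c → a * 0 + b * 1 + c * 0 ≡ b
    pick₁ = solve-∀
    pick₂ : ∀ a b c → a * 0 + b * 0 + c * 1 ≡ c
    pick₂ = solve-∀
    pick₀₂ : ∀ a b c → a * 1 + b * 0 + c * 1 ≡ a + c
    pick₀₂ = solve-∀

  ·-identityʳ : ∀ y → y · I ≗ y
  ·-identityʳ y 0F = pick₀ (y 0F) (y 1F) (y 2F)
  ·-identityʳ y 1F = pick₁ (y 0F) (y 1F) (y 2F)
  ·-identityʳ y 2F = pick₂ (y 0F) (y 1F) (y 2F)

  ·-P : ∀ ρ y → y · P ρ ≗ y ∘ (ρ ⟨$⟩ˡ_)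
  ·-P ρ y j rewrite P-as-I ρ 0F j | P-as-I ρ 1F j | P-as-I ρ 2F j = ·-identityʳ y (ρ ⟨$⟩ˡ j)

  ·-A₀ : ∀ y → y · A₀ ≗ y 1F ∷ y 2F ∷ y 0F + y 2F ∷ []
  ·-A₀ y 0F = pick₁ (y 0F) (y 1F) (y 2F)
  ·-A₀ y 1F = pick₂ (y 0F) (y 1F) (y 2F)
  ·-A₀ y 2F = pick₀₂ (y 0F) (y 1F) (y 2F)

  ·-A₁ : ∀ y → y · A₁ ≗ y 0F ∷ y 1F ∷ y 0F + y 2F ∷ []
  ·-A₁ y 0F = pick₀ (y 0F) (y 1F) (y 2F)
  ·-A₁ y 1F = pick₁ (y 0F) (y 1F) (y 2F)
  ·-A₁ y 2F = pick₀₂ (y 0F) (y 1F) (y 2F)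

  ·-P⊗A⊗P : ∀ σ A τ y → y · (P σ ⊗ A ⊗ P τ) ≗ ((y ∘ (σ ⟨$⟩ˡ_)) · A) ∘ (τ ⟨$⟩ˡ_)
  ·-P⊗A⊗P σ A τ y j = begin
    (y · (P σ ⊗ A ⊗ P τ)) j          ≡⟨ ·-⊗ y (P σ ⊗ A) (P τ) j ⟩
    (y · (P σ ⊗ A) · P τ) j          ≡⟨ ·-P τ (y · (P σ ⊗ A)) j ⟩
    (y · (P σ ⊗ A)) (τ ⟨$⟩ˡ j)       ≡⟨ ·-⊗ y (P σ) A (τ ⟨$⟩ˡ j) ⟩
    (y · P σ · A) (τ ⟨$⟩ˡ j)         ≡⟨ ·-congˡ A (·-P σ y) (τ ⟨$⟩ˡ j) ⟩
    ((y ∘ (σ ⟨$⟩ˡ_)) · A) (τ ⟨$⟩ˡ j) ∎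
    where open ≡-Reasoning

  Refines-A₀ : ∀ y → Refines y (y · A₀)
  Refines-A₀ y = Refines-congʳ refines (sym ∘ ·-A₀ y)
    where
    grows : ∀ a b c → b + (c + (a + c + 0)) ≡ a + (b + (c + 0)) + c
    grows = solve-∀
    refines : Refines y (y 1F ∷ y 2F ∷ y 0F + y 2F ∷ [])
    refines = record
      { total-grows = 2F , grows (y 0F) (y 1F) (y 2F)
      ; max-mono    = λ { 0F → 2F , ℕ.m≤m+n _ _ ; 1F → 0F , ℕ.≤-refl ; 2F → 1F , ℕ.≤-refl }
      ; min-mono    = λ { 0F → 1F , ℕ.≤-refl ; 1F → 2F , ℕ.≤-refl ; 2F → 0F , ℕ.m≤m+n _ _ }
      }

  Refines-A₁ : ∀ y → Refines y (y · A₁)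
  Refines-A₁ y = Refines-congʳ refines (sym ∘ ·-A₁ y)
    where
    grows : ∀ a b c → a + (b + (a + c + 0)) ≡ a + (b + (c + 0)) + a
    grows = solve-∀
    refines : Refines y (y 0F ∷ y 1F ∷ y 0F + y 2F ∷ [])
    refines = record
      { total-grows = 0F , grows (y 0F) (y 1F) (y 2F)
      ; max-mono    = λ { 0F → 0F , ℕ.≤-refl ; 1F → 1F , ℕ.≤-refl ; 2F → 2F , ℕ.m≤n+m _ _ }
      ; min-mono    = λ { 0F → 0F , ℕ.≤-refl ; 1F → 1F , ℕ.≤-refl ; 2F → 2F , ℕ.m≤n+m _ _ }
      }

  Refines-P⊗A⊗P : ∀ A → (∀ y → Refines y (y · A)) → ∀ σ τ y → Refines y (y · (P σ ⊗ A ⊗ P τ))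
  Refines-P⊗A⊗P A refines σ τ y =
    Refines-congʳ (Refines-rearrangeʳ (flip τ) (Refines-rearrangeˡ (flip σ) (refines (y ∘ (σ ⟨$⟩ˡ_)))))
                  (sym ∘ ·-P⊗A⊗P σ A τ y)

  Refines-F : ∀ c m e y → Refines y (y · F c m e)
  Refines-F c m 0F y with c m
  ... | σ , τ₀ , _ = Refines-P⊗A⊗P A₀ Refines-A₀ σ τ₀ y
  Refines-F c m 1F y with c m
  ... | σ , _ , τ₁ = Refines-P⊗A⊗P A₁ Refines-A₁ σ τ₁ y

  -- Integer left inverses and primitive columns

  Matℤ : Set
  Matℤ = Fin 3 → Fin 3 → ℤ

  infixl 7 _⊠_
  infix 4 _≐_ _≐?_

  _⊠_ : Matℤ → Matℤ → Matℤ
  (L ⊠ M) i j = L i 0F ℤ.* M 0F j ℤ.+ L i 1F ℤ.* M 1F j ℤ.+ L i 2F ℤ.* M 2F j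

  _≐_ : Matℤ → Matℤ → Set
  L ≐ M = ∀ i j → L i j ≡ M i j

  _≐?_ : ∀ L M → Dec (L ≐ M)
  L ≐? M = all? λ i → all? λ j → L i j ℤ.≟ M i j

  ι : Mat → Matℤ
  ι M i j = ℤ.+ M i j

  ι-⊗ : ∀ M N → ι (M ⊗ N) ≐ ι M ⊠ ι N
  ι-⊗ M N i j =
    trans (ℤ.pos-+ (M i 0F * N 0F j + M i 1F * N 1F j) (M i 2F * N 2F j))
          (cong₂ ℤ._+_ (trans (ℤ.pos-+ (M i 0F * N 0F j) (M i 1F * N 1F j))
                              (cong₂ ℤ._+_ (ℤ.pos-* (M i 0F) (N 0F j)) (ℤ.pos-* (M i 1F) (N 1F j))))
                       (ℤ.pos-* (M i 2F) (N 2F j)))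

  ⊠-assoc : ∀ L M N → L ⊠ M ⊠ N ≐ L ⊠ (M ⊠ N)
  ⊠-assoc L M N i j = assoc (L i 0F) (L i 1F) (L i 2F) (M 0F 0F) (M 0F 1F) (M 0F 2F) (M 1F 0F) (M 1F 1F) (M 1F 2F)
                            (M 2F 0F) (M 2F 1F) (M 2F 2F) (N 0F j) (N 1F j) (N 2F j)
    where
    assoc : ∀ l₀ l₁ l₂ m₀₀ m₀₁ m₀₂ m₁₀ m₁₁ m₁₂ m₂₀ m₂₁ m₂₂ n₀ n₁ n₂ →
        (l₀ ℤ.* m₀₀ ℤ.+ l₁ ℤ.* m₁₀ ℤ.+ l₂ ℤ.* m₂₀) ℤ.* n₀
        ℤ.+ (l₀ ℤ.* m₀₁ ℤ.+ l₁ ℤ.* m₁₁ ℤ.+ l₂ ℤ.* m₂₁) ℤ.* n₁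
        ℤ.+ (l₀ ℤ.* m₀₂ ℤ.+ l₁ ℤ.* m₁₂ ℤ.+ l₂ ℤ.* m₂₂) ℤ.* n₂
      ≡ l₀ ℤ.* (m₀₀ ℤ.* n₀ ℤ.+ m₀₁ ℤ.* n₁ ℤ.+ m₀₂ ℤ.* n₂)
        ℤ.+ l₁ ℤ.* (m₁₀ ℤ.* n₀ ℤ.+ m₁₁ ℤ.* n₁ ℤ.+ m₁₂ ℤ.* n₂)
        ℤ.+ l₂ ℤ.* (m₂₀ ℤ.* n₀ ℤ.+ m₂₁ ℤ.* n₁ ℤ.+ m₂₂ ℤ.* n₂)
    assoc = ℤ-solve-∀

  ⊠-congˡ : ∀ {L L′} M → L ≐ L′ → L ⊠ M ≐ L′ ⊠ M
  ⊠-congˡ M L≐L′ i j rewrite L≐L′ i 0F | L≐L′ i 1F | L≐L′ i 2F = refl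

  ⊠-congʳ : ∀ L {M M′} → M ≐ M′ → L ⊠ M ≐ L ⊠ M′
  ⊠-congʳ L M≐M′ i j rewrite M≐M′ 0F j | M≐M′ 1F j | M≐M′ 2F j = refl

  ⊗-identityˡ : ∀ M i j → (I ⊗ M) i j ≡ M i j
  ⊗-identityˡ M 0F j = trans (ℕ.+-identityʳ _) (trans (ℕ.+-identityʳ _) (ℕ.+-identityʳ _))
  ⊗-identityˡ M 1F j = trans (ℕ.+-identityʳ _) (ℕ.+-identityʳ _)
  ⊗-identityˡ M 2F j = ℕ.+-identityʳ _

  ι-I-⊠ : ∀ M → ι I ⊠ ι M ≐ ι M
  ι-I-⊠ M i j = trans (sym (ι-⊗ I M i j)) (cong ℤ.+_ (⊗-identityˡ M i j))

  record LeftInvertible (M : Mat) : Set where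
    constructor left-inverse
    field
      inverse    : Matℤ
      inverseˡ-≐ : inverse ⊠ ι M ≐ ι I

  LeftInvertible-⊗ : ∀ {M N} → LeftInvertible M → LeftInvertible N → LeftInvertible (M ⊗ N)
  LeftInvertible-⊗ {M} {N} (left-inverse L L-inv) (left-inverse K K-inv) = left-inverse (K ⊠ L) KL-inv
    where
    open ≡-Reasoning
    KL-inv : K ⊠ L ⊠ ι (M ⊗ N) ≐ ι I
    KL-inv i j = begin
      (K ⊠ L ⊠ ι (M ⊗ N)) i j     ≡⟨ ⊠-congʳ (K ⊠ L) (ι-⊗ M N) i j ⟩
      (K ⊠ L ⊠ (ι M ⊠ ι N)) i j   ≡⟨ ⊠-assoc K L (ι M ⊠ ι N) i j ⟩
      (K ⊠ (L ⊠ (ι M ⊠ ι N))) i j ≡⟨ ⊠-congʳ K (λ i′ j′ → sym (⊠-assoc L (ι M) (ι N) i′ j′)) i j ⟩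
      (K ⊠ (L ⊠ ι M ⊠ ι N)) i j   ≡⟨ ⊠-congʳ K (⊠-congˡ (ι N) L-inv) i j ⟩
      (K ⊠ (ι I ⊠ ι N)) i j       ≡⟨ ⊠-congʳ K (ι-I-⊠ N) i j ⟩
      (K ⊠ ι N) i j               ≡⟨ K-inv i j ⟩
      ι I i j                     ∎

  left-inverse-by-computation : ∀ L M → True (L ⊠ ι M ≐? ι I) → LeftInvertible M
  left-inverse-by-computation L M check = left-inverse L (toWitness check)

  LeftInvertible-B : LeftInvertible B
  LeftInvertible-B = left-inverse-by-computation
    ((ℤ.1ℤ ∷ ℤ.-1ℤ ∷ ℤ.0ℤ  ∷ []) ∷
     (ℤ.0ℤ ∷ ℤ.1ℤ  ∷ ℤ.-1ℤ ∷ []) ∷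
     (ℤ.0ℤ ∷ ℤ.0ℤ  ∷ ℤ.1ℤ  ∷ []) ∷ []) B _

  LeftInvertible-A₀ : LeftInvertible A₀
  LeftInvertible-A₀ = left-inverse-by-computation
    ((ℤ.0ℤ  ∷ ℤ.1ℤ ∷ ℤ.0ℤ ∷ []) ∷
     (ℤ.-1ℤ ∷ ℤ.0ℤ ∷ ℤ.1ℤ ∷ []) ∷
     (ℤ.1ℤ  ∷ ℤ.0ℤ ∷ ℤ.0ℤ ∷ []) ∷ []) A₀ _

  LeftInvertible-A₁ : LeftInvertible A₁
  LeftInvertible-A₁ = left-inverse-by-computation
    ((ℤ.1ℤ ∷ ℤ.0ℤ ∷ ℤ.-1ℤ ∷ []) ∷
     (ℤ.0ℤ ∷ ℤ.1ℤ ∷ ℤ.0ℤ  ∷ []) ∷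
     (ℤ.0ℤ ∷ ℤ.0ℤ ∷ ℤ.1ℤ  ∷ []) ∷ []) A₁ _

  P-flip-⊗-P : ∀ ρ i j → (P (flip ρ) ⊗ P ρ) i j ≡ I i j
  P-flip-⊗-P ρ i j = trans (·-P ρ (P (flip ρ) i) j) (I-injective (⟨$⟩ˡ-injective ρ) i j)

  LeftInvertible-P : ∀ ρ → LeftInvertible (P ρ)
  LeftInvertible-P ρ = left-inverse (ι (P (flip ρ))) λ i j →
    trans (sym (ι-⊗ (P (flip ρ)) (P ρ) i j)) (cong ℤ.+_ (P-flip-⊗-P ρ i j))

  LeftInvertible-P⊗A⊗P : ∀ {A} → LeftInvertible A → ∀ σ τ → LeftInvertible (P σ ⊗ A ⊗ P τ)
  LeftInvertible-P⊗A⊗P A-inv σ τ = LeftInvertible-⊗ (LeftInvertible-⊗ (LeftInvertible-P σ) A-inv) (LeftInvertible-P τ)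

  LeftInvertible-F : ∀ c m e → LeftInvertible (F c m e)
  LeftInvertible-F c m 0F with c m
  ... | σ , τ₀ , _ = LeftInvertible-P⊗A⊗P LeftInvertible-A₀ σ τ₀
  LeftInvertible-F c m 1F with c m
  ... | σ , _ , τ₁ = LeftInvertible-P⊗A⊗P LeftInvertible-A₁ σ τ₁

  LeftInvertible-vertexMatrix : ∀ c s n → LeftInvertible (vertexMatrix c s n)
  LeftInvertible-vertexMatrix c s zero    = LeftInvertible-⊗ LeftInvertible-B (LeftInvertible-F c 0 (s 0))
  LeftInvertible-vertexMatrix c s (suc n) =
    LeftInvertible-⊗ (LeftInvertible-vertexMatrix c s n) (LeftInvertible-F c (suc n) (s (suc n)))

  dot : (Fin 3 → ℤ) → Vec3 → ℤ
  dot w u = w 0F ℤ.* ℤ.+ u 0F ℤ.+ w 1F ℤ.* ℤ.+ u 1F ℤ.+ w 2F ℤ.* ℤ.+ u 2F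

  dot-congʳ : ∀ w {u v} → u ≗ v → dot w u ≡ dot w v
  dot-congʳ w u≗v rewrite u≗v 0F | u≗v 1F | u≗v 2F = refl

  dot-scale : ∀ w u t → dot w u ℤ.* ℤ.+ t ≡ dot w (λ r → u r * t)
  dot-scale w u t =
    trans (distrib (w 0F) (w 1F) (w 2F) (ℤ.+ u 0F) (ℤ.+ u 1F) (ℤ.+ u 2F) (ℤ.+ t))
          (cong₂ ℤ._+_ (cong₂ ℤ._+_ (scale 0F) (scale 1F)) (scale 2F))
    where
    distrib : ∀ w₀ w₁ w₂ a₀ a₁ a₂ t →
        (w₀ ℤ.* a₀ ℤ.+ w₁ ℤ.* a₁ ℤ.+ w₂ ℤ.* a₂) ℤ.* t
      ≡ w₀ ℤ.* (a₀ ℤ.* t) ℤ.+ w₁ ℤ.* (a₁ ℤ.* t) ℤ.+ w₂ ℤ.* (a₂ ℤ.* t)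
    distrib = ℤ-solve-∀
    scale : ∀ r → w r ℤ.* (ℤ.+ u r ℤ.* ℤ.+ t) ≡ w r ℤ.* ℤ.+ (u r * t)
    scale r = cong (w r ℤ.*_) (sym (ℤ.pos-* (u r) t))

  samePoint-sym : ∀ u v → samePoint u v → samePoint v u
  samePoint-sym u v (eq₁ , eq₂) = sym eq₁ , sym eq₂

  samePoint-cross : ∀ u v → samePoint u v → (λ r → u r * v 0F) ≗ (λ r → v r * u 0F)
  samePoint-cross u v _         0F = ℕ.*-comm (u 0F) (v 0F)
  samePoint-cross u v (eq₁ , _) 1F = eq₁
  samePoint-cross u v (_ , eq₂) 2F = eq₂

  primitive-∣ : ∀ w u v → dot w u ≡ ℤ.1ℤ → samePoint u v → u 0F ∣ v 0F
  primitive-∣ w u v wu≡1 same =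
    divides ℤ.∣ dot w v ∣ (trans (cong ℤ.∣_∣ scaled) (ℤ.abs-* (dot w v) (ℤ.+ u 0F)))
    where
    open ≡-Reasoning
    scaled : ℤ.+ v 0F ≡ dot w v ℤ.* ℤ.+ u 0F
    scaled = begin
      ℤ.+ v 0F                 ≡⟨ ℤ.*-identityˡ _ ⟨
      ℤ.1ℤ ℤ.* ℤ.+ v 0F        ≡⟨ cong (ℤ._* ℤ.+ v 0F) wu≡1 ⟨
      dot w u ℤ.* ℤ.+ v 0F     ≡⟨ dot-scale w u (v 0F) ⟩
      dot w (λ r → u r * v 0F) ≡⟨ dot-congʳ w (samePoint-cross u v same) ⟩
      dot w (λ r → v r * u 0F) ≡⟨ dot-scale w v (u 0F) ⟨
      dot w v ℤ.* ℤ.+ u 0F     ∎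

  LeftInvertible-column-primitive : ∀ {M} → LeftInvertible M → ∀ i → ∃[ w ] dot w (λ r → M r i) ≡ ℤ.1ℤ
  LeftInvertible-column-primitive (left-inverse L L-inv) i = L i , trans (L-inv i i) (cong ℤ.+_ (I-diagonal i))

  samePoint-first-coordinate : ∀ {M N} → LeftInvertible M → LeftInvertible N →
    ∀ i j → samePoint (λ r → M r i) (λ r → N r j) → M 0F i ≡ N 0F j
  samePoint-first-coordinate {M} {N} M-inv N-inv i j same =
    let w , w-primitive = LeftInvertible-column-primitive M-inv i
        w′ , w′-primitive = LeftInvertible-column-primitive N-inv j
        u = λ r → M r i
        v = λ r → N r j
    in ∣-antisym (primitive-∣ w u v w-primitive same)
                 (primitive-∣ w′ v u w′-primitive (samePoint-sym u v same))

  -- The first coordinates of the vertices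

  -- x c s (suc n) is definitionally x c s n · F c (suc n) (s (suc n)), and x c s 0 is B 0F · F c 0 (s 0).
  x-refines : ∀ c s n → Refines (x c s n) (x c s (suc n))
  x-refines c s n = Refines-F c (suc n) (s (suc n)) (x c s n)

  x-positive : ∀ c s n i → 1 ≤ x c s n i
  x-positive c s zero    =
    Refines-positive (Refines-F c 0 (s 0) (B 0F)) λ { 0F → ℕ.≤-refl ; 1F → ℕ.≤-refl ; 2F → ℕ.≤-refl }
  x-positive c s (suc n) = Refines-positive (x-refines c s n) (x-positive c s n)

  samePoint-x-≡ : ∀ c s n m i j → samePoint (X c s n i) (X c s m j) → x c s n i ≡ x c s m j
  samePoint-x-≡ c s n m =
    samePoint-first-coordinate (LeftInvertible-vertexMatrix c s n) (LeftInvertible-vertexMatrix c s m)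

  -- Rational inequalities, cross-multiplied

  toℚᵘ-ℕtoℚ : ∀ n → toℚᵘ (ℕtoℚ n) ≡ ℚᵘ.mkℚᵘ (ℤ.+ n) 0
  toℚᵘ-ℕtoℚ n = cong toℚᵘ (normalize-coprime (Coprimality.sym (1-coprimeTo n)))

  ℕtoℚ-≤-* : ∀ a b p d-1 .{cop : Coprime ℤ.∣ p ∣ (suc d-1)} →
    ℕtoℚ a ℚ.≤ mkℚ p d-1 cop ℚ.* ℕtoℚ b → ℤ.+ a ℤ.* ℤ.+ suc d-1 ℤ.≤ p ℤ.* ℤ.+ b
  ℕtoℚ-≤-* a b p d-1 {cop} a≤Cb
    with ℚᵘ.≤-respʳ-≃ (toℚᵘ-homo-* (mkℚ p d-1 cop) (ℕtoℚ b)) (toℚᵘ-mono-≤ a≤Cb)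
  ... | le rewrite toℚᵘ-ℕtoℚ a | toℚᵘ-ℕtoℚ b with le
  ... | ℚᵘ.*≤* le′ =
    subst₂ ℤ._≤_ (cong (λ t → ℤ.+ a ℤ.* ℤ.+ suc t) (ℕ.*-identityʳ d-1)) (ℤ.*-identityʳ (p ℤ.* ℤ.+ b)) le′

  ℕtoℚ-RatioBounded : ∀ {n c d-1} .{cop : Coprime c (suc d-1)} {v : Vector ℕ n} →
    (∀ a b → ℕtoℚ (v a) ℚ.≤ mkℚ (ℤ.+ c) d-1 cop ℚ.* ℕtoℚ (v b)) → RatioBounded c (suc d-1) v
  ℕtoℚ-RatioBounded {c = c} {d-1} {v = v} bounded = ratio-bounded λ a b →
    ℤ.drop‿+≤+ (subst₂ ℤ._≤_ (trans (ℤ.*-comm (ℤ.+ v a) _) (sym (ℤ.pos-* (suc d-1) (v a))))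
                             (sym (ℤ.pos-* c (v b)))
                             (ℕtoℚ-≤-* (v a) (v b) (ℤ.+ c) d-1 (bounded a b)))

  ℕtoℚ≰negative*ℕtoℚ : ∀ {a q d-1} .{cop : Coprime (suc q) (suc d-1)} → 1 ≤ a →
    ℕtoℚ a ℚ.≤ mkℚ ℤ.-[1+ q ] d-1 cop ℚ.* ℕtoℚ a → ⊥
  ℕtoℚ≰negative*ℕtoℚ {suc a} {q} {d-1} _ a≤Ca with ℕtoℚ-≤-* (suc a) (suc a) ℤ.-[1+ q ] d-1 a≤Ca
  ... | ()

  ℕtoℚ-<-* : ∀ m k c d-1 .{cop : Coprime c (suc d-1)} → let C = mkℚ (ℤ.+ c) d-1 cop in
    ℕtoℚ m ℚ.* (C ℚ.* C) ℚ.< ℕtoℚ k → m * (c * c) < k * (suc d-1 * suc d-1)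
  ℕtoℚ-<-* m k c d-1 {cop} lt
    with ℚᵘ.<-respˡ-≃ (ℚᵘ.≃-trans (toℚᵘ-homo-* (ℕtoℚ m) (C ℚ.* C))
                                  (ℚᵘ.*-congˡ {toℚᵘ (ℕtoℚ m)} (toℚᵘ-homo-* C C)))
                      (toℚᵘ-mono-< lt)
    where
    C : ℚ
    C = mkℚ (ℤ.+ c) d-1 cop
  ... | le rewrite toℚᵘ-ℕtoℚ m | toℚᵘ-ℕtoℚ k with le
  ... | ℚᵘ.*<* le′ = ℤ.drop‿+<+ (subst₂ ℤ._<_ lhs rhs le′)
    where
    lhs : ℤ.+ m ℤ.* (ℤ.+ c ℤ.* ℤ.+ c) ℤ.* ℤ.1ℤ ≡ ℤ.+ (m * (c * c))
    lhs = trans (ℤ.*-identityʳ _) (trans (cong (ℤ.+ m ℤ.*_) (sym (ℤ.pos-* c c))) (sym (ℤ.pos-* m (c * c))))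
    -- the denominator of toℚᵘ (ℕtoℚ m) ℚᵘ.* (toℚᵘ C ℚᵘ.* toℚᵘ C), in normal form
    rhs : ℤ.+ k ℤ.* ℤ.+ suc (d-1 + d-1 * suc d-1 + 0) ≡ ℤ.+ (k * (suc d-1 * suc d-1))
    rhs = trans (cong (λ t → ℤ.+ k ℤ.* ℤ.+ suc t) (ℕ.+-identityʳ _)) (sym (ℤ.pos-* k _))

open VertexCoordinates

open import Data.Nat using (ℕ; _+_)
import Data.Nat.Properties as ℕ
open import Data.Fin using (Fin)
open import Data.Fin.Patterns using (0F)
open import Data.Integer using (+_; -[1+_])
open import Data.Rational using (ℚ; mkℚ; _*_; _≤_; _<_)
open import Data.Empty using (⊥-elim)
open import Relation.Nullary using (¬_)
open import Relation.Binary.PropositionalEquality using (sym)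

mainTheorem6 : (c : Combination) (s : ℕ → Fin 2) (C : ℚ) →
    (∀ n i j → ℕtoℚ (x c s n i) ≤ C * ℕtoℚ (x c s n j)) →
    ∀ n i k → ℕtoℚ 2 * (C * C) < ℕtoℚ k →
    ∀ j → ¬ samePoint (X c s n i) (X c s (n + k) j)
mainTheorem6 c s (mkℚ (+ c′) d-1 cop) bounded n i k big j same =
  ℕ.<⇒≱ (ℕtoℚ-<-* 2 k c′ d-1 {cop} big)
        (revisit-bound (x-refines c s) (λ m → ℕtoℚ-RatioBounded (bounded m)) n i k j
                       (x-positive c s n i) (sym (samePoint-x-≡ c s n (n + k) i j same)))
mainTheorem6 c s (mkℚ -[1+ _ ] _ _) bounded _ _ _ _ _ _ =
  ⊥-elim (ℕtoℚ≰negative*ℕtoℚ (x-positive c s 0 0F) (bounded 0 0F 0F))
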